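{- Run algorithm Tight-VC-HC on an instance of VC-HC admitting a feasible assignment, with maximum edge size $f\ge2$, and let $k$ be the number of iterations of Step 2 (the $k$-th being the one that proceeds to Step 3). For $1\le i\le k$ let $\boldsymbol\ell^{(i)}$ be the vector $\boldsymbol\ell$ at the start of iteration $i$ and $(\mathbf x^{(i)},\mathbf h^{(i)})$ the basic optimal solution computed in iteration $i$. Then for all $1\le i<k$ and all $v\in V$, $\ell^{(i)}_v\le\ell^{(i+1)}_v\le x^{(i)}_v$; furthermore, $\ell^{(i)}_v>0$ implies $1/f\le\ell^{(i)}_v\le1$.
   Context: VC-HC: a hypergraph $G=(V,E)$ with $E\subseteq 2^V$, $f:=\max_{e\in E}|e|$; demands $d_e\ge0$, capacities $c_v\ge0$, integer multiplicities $m_v\ge0$. An assignment $h$ with $h_{e,v}\ge0$ ($e\in E,v\in e$) is feasible if $\sum_{v\in e}h_{e,v}=1$ for all $e$ and $\lceil\sum_{e\ni v}d_eh_{e,v}/c_v\rceil\le m_v$ for all $v$. For $E'\subseteq E$, $\mathbf0\le\boldsymbol\ell\le\mathbf m$ and capacities $\mathbf c'$, $\mathrm{LP}(E',\boldsymbol\ell,\mathbf c')$ minimizes $\sum_{v\in V}x_v$ subject to: $\sum_{v\in e}h_{e,v}=1$ ($e\in E'$); $\sum_{e\in E',\,v\in e}d_eh_{e,v}\le c'_vx_v$ ($v\in V$); $\ell_v\le x_v\le m_v$ ($v\in V$); $0\le h_{e,v}\le x_v$ ($e\in E'$, $v\in e$). A basic optimal solution is an optimal extreme point of the feasible region. Algorithm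 Tight-VC-HC. Step 1: set $\mathcal E:=E$, $h'_{e,v}:=0$, $\ell_v:=0$, $c'_v:=c_v$. Step 2: repeat: (a) solve $\mathrm{LP}(\mathcal E,\boldsymbol\ell,\mathbf c')$ for a basic optimal solution $(\mathbf x,\mathbf h)$; (b) $I:=\{v:0<x_v<1/f\}$; (c) for $e\in\mathcal E$, $T(e):=\{v\in e\setminus I:0<h_{e,v}=x_v\}$; (d) if all $T(e)$ are empty go to Step 3; (e) for each $e\in\mathcal E$ with $T(e)\ne\emptyset$: pick an arbitrary $v\in T(e)$ and set $h'_{e,v}:=1$; for all $v\in T(e)$ decrease $c'_v$ by $d_e$ and set $\ell_v:=x_v$; remove $e$ from $\mathcal E$. Step 3: output $x^*_v:=\lceil x_v\rceil$ and $h^*_{e,v}:=h_{e,v}$ if $e\in\mathcal E$, $h^*_{e,v}:=h'_{e,v}$ otherwise (using the last iteration's values).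
   Formalization: The demands $d_e$, the capacities $c_v$, the feasible assignment and all LP points, including the basic optimal solutions $(\mathbf x,\mathbf h)$, take rational values. -}

module Defs where

open import Data.Nat as ℕ using (ℕ; zero; suc)
open import Data.Integer as ℤ using (ℤ)
open import Data.Fin using (Fin; zero; suc)
open import Data.Fin.Subset using (Subset; _∈_; _∉_; ∣_∣)
open import Data.Fin.Subset.Properties using (_∈?_)
open import Data.Rational as ℚ
  using (ℚ; 0ℚ; 1ℚ; _+_; _*_; _-_; _≤_; _<_; _÷_; ≢-nonZero; ceiling)
open import Data.Rational.Properties using (_≟_; _<?_)
open import Data.Product using (_×_; Σ; ∃; _,_)
open import Data.Empty using (⊥)
open import Relation.Nullary using (¬_; Dec; yes; no)
open import Relation.Nullary.Decidable using (_×-dec_; ¬?)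
open import Relation.Binary.PropositionalEquality using (_≡_; _≢_)

∑ : ∀ {n} → (Fin n → ℚ) → ℚ
∑ {zero}  g = 0ℚ
∑ {suc n} g = g zero + ∑ {n} (λ i → g (suc i))

∑[_]_ : ∀ {n} {P : Fin n → Set} → (∀ i → Dec (P i)) → (Fin n → ℚ) → ℚ
∑[ P? ] g = ∑ (λ i → cond (P? i) (g i))
  where
  cond : ∀ {A : Set} → Dec A → ℚ → ℚ
  cond (yes _) q = q
  cond (no _)  _ = 0ℚ

maxFin : ∀ {m} → (Fin m → ℕ) → ℕ
maxFin {zero}  g = 0
maxFin {suc m} g = g zero ℕ.⊔ maxFin {m} (λ i → g (suc i))

-- 1/k as a rational (convention: 0 for k = 0; only used with k ≥ 2)
recipℕ : ℕ → ℚ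
recipℕ zero    = 0ℚ
recipℕ (suc k) = ℤ.+ 1 ℚ./ suc k

-- VC-HC instances: vertices Fin n, hyperedges Fin m (each a subset of
-- the vertices), demands d, capacities c, multiplicities mult.

record Instance : Set where
  field
    n m   : ℕ
    edge  : Fin m → Subset n
    -- E ⊆ 2^V is a set: distinct indices give distinct hyperedges
    edge-inj : ∀ e e′ → edge e ≡ edge e′ → e ≡ e′
    d     : Fin m → ℚ
    c     : Fin n → ℚ
    mult  : Fin n → ℕ
    d≥0   : ∀ e → 0ℚ ≤ d e
    c≥0   : ∀ v → 0ℚ ≤ c v

module _ (I : Instance) where
  open Instance I

  fmax : ℕ
  fmax = maxFin (λ e → ∣ edge e ∣)

  load : Subset m → (Fin m → Fin n → ℚ) → Fin n → ℚ
  load E′ h v = ∑[ (λ e → (e ∈? E′) ×-dec (v ∈? edge e)) ] (λ e → d e * h e v)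

  -- ⌈ load / c_v ⌉ ≤ m_v  (convention for c_v = 0: the load must be 0)
  CapOK : ℚ → ℚ → ℕ → Set
  CapOK L cv mv with cv ≟ 0ℚ
  ... | yes _   = L ≡ 0ℚ
  ... | no cv≢0 = ceiling (_÷_ L cv {{≢-nonZero cv≢0}}) ℤ.≤ ℤ.+ mv

  FeasibleAssignment : (Fin m → Fin n → ℚ) → Set
  FeasibleAssignment h =
      (∀ e v → v ∈ edge e → 0ℚ ≤ h e v)
    × (∀ e → ∑[ (λ v → v ∈? edge e) ] (λ v → h e v) ≡ 1ℚ)
    × (∀ v → CapOK (load Data.Fin.Subset.⊤ h v) (c v) (mult v))

  -- A point is (x, h) with x : ℚ^V and h : ℚ^(E×V);
  -- coordinates h_{e,v} that are not variables of the LP (e ∉ E′ or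
  -- v ∉ e) are fixed to 0, which does not change extreme points.

  Point : Set
  Point = (Fin n → ℚ) × (Fin m → Fin n → ℚ)

  LPFeasible : Subset m → (Fin n → ℚ) → (Fin n → ℚ) → Point → Set
  LPFeasible E′ ℓ c′ (x , h) =
      (∀ e → e ∈ E′ → ∑[ (λ v → v ∈? edge e) ] (λ v → h e v) ≡ 1ℚ)
    × (∀ v → load E′ h v ≤ c′ v * x v)
    × (∀ v → ℓ v ≤ x v × x v ≤ (ℤ.+ mult v ℚ./ 1))
    × (∀ e v → e ∈ E′ → v ∈ edge e → 0ℚ ≤ h e v × h e v ≤ x v)
    × (∀ e v → ¬ (e ∈ E′ × v ∈ edge e) → h e v ≡ 0ℚ)

  objective : Point → ℚ
  objective (x , h) = ∑ x

  LPOptimal : Subset m → (Fin n → ℚ) → (Fin n → ℚ) → Point → Set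
  LPOptimal E′ ℓ c′ p =
    LPFeasible E′ ℓ c′ p × (∀ q → LPFeasible E′ ℓ c′ q → objective p ≤ objective q)

  _≈P_ : Point → Point → Set
  (x , h) ≈P (x′ , h′) = (∀ v → x v ≡ x′ v) × (∀ e v → h e v ≡ h′ e v)

  IsConvComb : ℚ → Point → Point → Point → Set
  IsConvComb λ′ (x , h) (x₁ , h₁) (x₂ , h₂) =
      (∀ v → x v ≡ λ′ * x₁ v + (1ℚ - λ′) * x₂ v)
    × (∀ e v → h e v ≡ λ′ * h₁ e v + (1ℚ - λ′) * h₂ e v)

  IsExtreme : Subset m → (Fin n → ℚ) → (Fin n → ℚ) → Point → Set
  IsExtreme E′ ℓ c′ p =
    LPFeasible E′ ℓ c′ p ×
    (∀ p₁ p₂ λ′ → LPFeasible E′ ℓ c′ p₁ → LPFeasible E′ ℓ c′ p₂ →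
       0ℚ < λ′ → λ′ < 1ℚ → IsConvComb λ′ p p₁ p₂ → p₁ ≈P p₂)

  BasicOptimal : Subset m → (Fin n → ℚ) → (Fin n → ℚ) → Point → Set
  BasicOptimal E′ ℓ c′ p = LPOptimal E′ ℓ c′ p × IsExtreme E′ ℓ c′ p

  inI? : (x : Fin n → ℚ) → (v : Fin n) → Dec (0ℚ < x v × x v < recipℕ fmax)
  inI? x v = (0ℚ <? x v) ×-dec (x v <? recipℕ fmax)

  InT : Point → Fin m → Fin n → Set
  InT (x , h) e v =
    v ∈ edge e × ¬ (0ℚ < x v × x v < recipℕ fmax) × 0ℚ < h e v × h e v ≡ x v

  inT? : (p : Point) → ∀ e v → Dec (InT p e v)
  inT? (x , h) e v =
    (v ∈? edge e) ×-dec (¬? (inI? x v) ×-dec ((0ℚ <? h e v) ×-dec (h e v ≟ x v)))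

  AllTEmpty : Subset m → Point → Set
  AllTEmpty 𝓔 p = ∀ e v → e ∈ 𝓔 → ¬ InT p e v

  record State : Set where
    constructor st
    field
      𝓔  : Subset m
      ℓ  : Fin n → ℚ
      c′ : Fin n → ℚ

  initial : State
  initial = st Data.Fin.Subset.⊤ (λ _ → 0ℚ) c

  -- Step 2(e): the successor state (the arbitrary choice of h′ does not
  -- affect 𝓔, ℓ, c′ and is not recorded)
  Step : State → Point → State → Set
  Step (st 𝓔 ℓ c′) (x , h) (st 𝓔₁ ℓ₁ c′₁) = let p = (x , h) in
      (∀ e → e ∈ 𝓔₁ → e ∈ 𝓔 × (∀ v → ¬ InT p e v))
    × (∀ e → e ∈ 𝓔 → (∀ v → ¬ InT p e v) → e ∈ 𝓔₁)
    × (∀ v → c′₁ v ≡ c′ v - ∑[ (λ e → (e ∈? 𝓔) ×-dec inT? p e v) ] d)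
    × (∀ v → (Σ (Fin m) λ e → e ∈ 𝓔 × InT p e v) → ℓ₁ v ≡ x v)
    × (∀ v → ¬ (Σ (Fin m) λ e → e ∈ 𝓔 × InT p e v) → ℓ₁ v ≡ ℓ v)

  -- A complete run of Tight-VC-HC with k iterations of Step 2.
  -- state i / sol i are meaningful for 1 ≤ i ≤ k.
  record Run (k : ℕ) : Set where
    field
      state : ℕ → State
      sol   : ℕ → Point
      k≥1   : 1 ℕ.≤ k
      start : state 1 ≡ initial
      basic : ∀ i → 1 ℕ.≤ i → i ℕ.≤ k →
                BasicOptimal (State.𝓔 (state i)) (State.ℓ (state i))
                             (State.c′ (state i)) (sol i)
      continue : ∀ i → 1 ℕ.≤ i → i ℕ.< k →
                   ¬ AllTEmpty (State.𝓔 (state i)) (sol i)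
                   × Step (state i) (sol i) (state (suc i))
      stop  : AllTEmpty (State.𝓔 (state k)) (sol k)

module Submission where

-- The vector ℓ changes only in Step 2(e): for every vertex v
-- lying in some T(e), e ∈ 𝓔, it is reset to x_v, and otherwise it stays.
-- Since every LP point satisfies ℓ_v ≤ x_v, each such update is monotone
-- and stays below x_v; this gives the first claim, for one step at a time.
-- For the second claim, a vertex v ∈ T(e) is not in I and has
-- 0 < h_{e,v} = x_v, so x_v ≥ 1/f; and h_{e,v} is one of the nonnegative
-- terms of ∑_{u∈e} h_{e,u} = 1, so x_v ≤ 1.  Hence the property
-- "ℓ_v > 0 ⇒ 1/f ≤ ℓ_v ≤ 1" holds for the initial ℓ = 0 and is preserved
-- by each step, and induction over the iterations of a run concludes.

open import Defs
open import Data.Nat using (ℕ; suc) renaming (_≤_ to _≤ℕ_; _<_ to _<ℕ_)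
open import Data.Fin using (Fin)
open import Data.Rational using (0ℚ; 1ℚ; _≤_; _<_)
open import Data.Product using (_×_; Σ)

open import Data.Nat using (zero; s≤s; z≤n)
open import Data.Nat.Properties using (<⇒≤)
open import Data.Fin using (zero; suc)
open import Data.Fin.Properties using (any?)
open import Data.Fin.Subset using (_∈_)
open import Data.Fin.Subset.Properties using (_∈?_)
open import Data.Rational using (ℚ; _+_)
open import Data.Rational.Properties
  using (≤-refl; ≤-trans; ≤-reflexive; <-irrefl; ≮⇒≥; +-mono-≤; +-identityˡ; +-identityʳ)
open import Data.Product using (_,_; proj₁; proj₂)
open import Data.Empty using (⊥-elim)
open import Relation.Nullary using (Dec; yes; no; ¬_)
open import Relation.Nullary.Decidable using (_×-dec_)
open import Relation.Binary.PropositionalEquality using (refl; sym; subst)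

≤-+-nonnegʳ : ∀ p {q} → 0ℚ ≤ q → p ≤ p + q
≤-+-nonnegʳ p {q} 0≤q =
  ≤-trans (≤-reflexive (sym (+-identityʳ p))) (+-mono-≤ (≤-refl {p}) 0≤q)

≤-+-nonnegˡ : ∀ {p} q → 0ℚ ≤ p → q ≤ p + q
≤-+-nonnegˡ {p} q 0≤p =
  ≤-trans (≤-reflexive (sym (+-identityˡ q))) (+-mono-≤ 0≤p (≤-refl {q}))

∑-nonneg : ∀ {n} {P : Fin n → Set} (P? : ∀ i → Dec (P i)) (g : Fin n → ℚ) →
  (∀ i → P i → 0ℚ ≤ g i) → 0ℚ ≤ ∑[ P? ] g
∑-nonneg {zero}  P? g g≥0 = ≤-refl
∑-nonneg {suc n} P? g g≥0 with P? zero
... | yes P0 = ≤-trans rest≥0 (≤-+-nonnegˡ _ (g≥0 zero P0))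
  where rest≥0 = ∑-nonneg (λ i → P? (suc i)) (λ i → g (suc i)) (λ i → g≥0 (suc i))
... | no _   = ≤-trans rest≥0 (≤-+-nonnegˡ _ ≤-refl)
  where rest≥0 = ∑-nonneg (λ i → P? (suc i)) (λ i → g (suc i)) (λ i → g≥0 (suc i))

term≤∑ : ∀ {n} {P : Fin n → Set} (P? : ∀ i → Dec (P i)) (g : Fin n → ℚ) →
  (∀ i → P i → 0ℚ ≤ g i) → ∀ j → P j → g j ≤ ∑[ P? ] g
term≤∑ {suc n} P? g g≥0 zero Pj with P? zero
... | yes _  = ≤-+-nonnegʳ _ (∑-nonneg (λ i → P? (suc i)) (λ i → g (suc i)) (λ i → g≥0 (suc i)))
... | no ¬P0 = ⊥-elim (¬P0 Pj)
term≤∑ {suc n} P? g g≥0 (suc j) Pj with P? zero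
... | yes P0 = ≤-trans later (≤-+-nonnegˡ _ (g≥0 zero P0))
  where later = term≤∑ (λ i → P? (suc i)) (λ i → g (suc i)) (λ i → g≥0 (suc i)) j Pj
... | no _   = ≤-trans later (≤-+-nonnegˡ _ ≤-refl)
  where later = term≤∑ (λ i → P? (suc i)) (λ i → g (suc i)) (λ i → g≥0 (suc i)) j Pj

module _ (I : Instance) where
  open Instance I

  InRange : ℚ → Set
  InRange q = recipℕ (fmax I) ≤ q × q ≤ 1ℚ

  PositiveInRange : (Fin n → ℚ) → Set
  PositiveInRange ℓ = ∀ v → 0ℚ < ℓ v → InRange (ℓ v)

  -- In any feasible point of LP(E′, ℓ, c′), a vertex of T(e) for an edge
  -- e ∈ E′ has x_v ∈ [1/f, 1]: below 1/f it would lie in I, and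
  -- x_v = h_{e,v} is a nonnegative part of ∑_{u∈e} h_{e,u} = 1.
  T-inRange : ∀ {E′ ℓ c′ x h} → LPFeasible I E′ ℓ c′ (x , h) →
    ∀ {e v} → e ∈ E′ → InT I (x , h) e v → InRange (x v)
  T-inRange {x = x} {h} (covered , _ , _ , h-bounds , _) {e} {v} e∈E′ (v∈e , v∉I , 0<h , h≡x) =
    ≮⇒≥ below-1/f⇒inI , subst (_≤ 1ℚ) h≡x h≤1
    where
    below-1/f⇒inI : ¬ (x v < recipℕ (fmax I))
    below-1/f⇒inI x<1/f = v∉I (subst (0ℚ <_) h≡x 0<h , x<1/f)

    h≤1 : h e v ≤ 1ℚ
    h≤1 = subst (h e v ≤_) (covered e e∈E′)
            (term≤∑ (λ u → u ∈? edge e) (h e) (λ u u∈e → proj₁ (h-bounds e u e∈E′ u∈e)) v v∈e)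

  Updated : State I → Point I → Fin n → Set
  Updated s p v = Σ (Fin m) λ e → e ∈ State.𝓔 s × InT I p e v

  updated? : ∀ s p v → Dec (Updated s p v)
  updated? s p v = any? (λ e → (e ∈? State.𝓔 s) ×-dec inT? I p e v)

  -- One step of the algorithm moves ℓ_v up to x_v or leaves it alone;
  -- as ℓ_v ≤ x_v holds in the LP, both give ℓ_v ≤ ℓ′_v ≤ x_v.
  step-ℓ-between : ∀ {s x h s′} →
    LPFeasible I (State.𝓔 s) (State.ℓ s) (State.c′ s) (x , h) → Step I s (x , h) s′ →
    ∀ v → State.ℓ s v ≤ State.ℓ s′ v × State.ℓ s′ v ≤ x v
  step-ℓ-between {s} {x} {h} (_ , _ , x-bounds , _) (_ , _ , _ , ℓ-set , ℓ-kept) v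
    with updated? s (x , h) v
  ... | yes upd rewrite ℓ-set v upd  = proj₁ (x-bounds v) , ≤-refl
  ... | no ¬upd rewrite ℓ-kept v ¬upd = ≤-refl , proj₁ (x-bounds v)

  step-preserves-range : ∀ {s x h s′} →
    LPFeasible I (State.𝓔 s) (State.ℓ s) (State.c′ s) (x , h) → Step I s (x , h) s′ →
    PositiveInRange (State.ℓ s) → PositiveInRange (State.ℓ s′)
  step-preserves-range {s} {x} {h} feasible (_ , _ , _ , ℓ-set , ℓ-kept) inRange v 0<ℓ′
    with updated? s (x , h) v
  ... | yes (e , e∈𝓔 , v∈T) rewrite ℓ-set v (e , e∈𝓔 , v∈T) =
    T-inRange {c′ = State.c′ s} feasible e∈𝓔 v∈T
  ... | no ¬upd rewrite ℓ-kept v ¬upd = inRange v 0<ℓ′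

  initial-inRange : PositiveInRange (State.ℓ (initial I))
  initial-inRange v 0<0 = ⊥-elim (<-irrefl refl 0<0)

  module _ {k : ℕ} (R : Run I k) where
    open Run R

    feasible-at : ∀ i → 1 ≤ℕ i → i ≤ℕ k →
      LPFeasible I (State.𝓔 (state i)) (State.ℓ (state i)) (State.c′ (state i)) (sol i)
    feasible-at i 1≤i i≤k = proj₁ (proj₁ (basic i 1≤i i≤k))

    run-ℓ-between : ∀ i → 1 ≤ℕ i → i <ℕ k → ∀ v →
      State.ℓ (state i) v ≤ State.ℓ (state (suc i)) v × State.ℓ (state (suc i)) v ≤ proj₁ (sol i) v
    run-ℓ-between i 1≤i i<k =
      step-ℓ-between {s = state i} (feasible-at i 1≤i (<⇒≤ i<k)) (proj₂ (continue i 1≤i i<k))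

    run-inRange : ∀ i → 1 ≤ℕ i → i ≤ℕ k → PositiveInRange (State.ℓ (state i))
    run-inRange (suc zero) _ _ = subst (λ s → PositiveInRange (State.ℓ s)) (sym start) initial-inRange
    run-inRange (suc (suc j)) _ j+2≤k =
      step-preserves-range {s = state (suc j)} (feasible-at (suc j) 1≤j+1 (<⇒≤ j+2≤k)) (proj₂ (continue (suc j) 1≤j+1 j+2≤k))
        (run-inRange (suc j) 1≤j+1 (<⇒≤ j+2≤k))
      where 1≤j+1 = s≤s z≤n

proposition1 : (I : Instance) →
    Σ (Fin (Instance.m I) → Fin (Instance.n I) → _) (FeasibleAssignment I) →
    2 ≤ℕ fmax I →
    (k : ℕ) → (R : Run I k) →
    let ℓ = λ i → State.ℓ (Run.state R i)
        x = λ i → Data.Product.proj₁ (Run.sol R i)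
    in ((i : ℕ) → 1 ≤ℕ i → i <ℕ k → (v : Fin (Instance.n I)) →
          ℓ i v ≤ ℓ (suc i) v × ℓ (suc i) v ≤ x i v)
     × ((i : ℕ) → 1 ≤ℕ i → i ≤ℕ k → (v : Fin (Instance.n I)) →
          0ℚ < ℓ i v → recipℕ (fmax I) ≤ ℓ i v × ℓ i v ≤ 1ℚ)
proposition1 I _ _ k R = run-ℓ-between I R , run-inRange I R
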